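{- Let $n\ge 1$ and $1\le d\le n$ be integers and let $F(x_1,\dots,x_n)=\sum_{I\in\mathcal I_d(n)} f_I x_I$ be an integer multilinear $(n,d)$-form which is coprime, i.e. $\gcd(f_I)_{I\in\mathcal I_d(n)}=1$. Suppose in addition that at least one of the following two conditions holds: (a) the nonzero coefficients $f_I$ of $F$ are pairwise coprime; (b) $n=d+1$ and $F$ has a pair of coprime coefficients (i.e. there exist $I\neq J$ in $\mathcal I_d(n)$ with $\gcd(f_I,f_J)=1$). Then $F$ represents all integers. Moreover, for each $b\in\mathbb Z$ there exists $\mathbf a\in\mathbb Z^n$ with $F(\mathbf a)=b$ and $$|\mathbf a|\le |b|\,(2|F|)^{d!\,\mathrm e},$$ where $\mathrm e=2.71828\ldots$ is Euler's number.
   Context: $[n]=\{1,\dots,n\}$ and $\mathcal I_d(n)=\{I\subseteq[n]: |I|=d\}$. For $I=\{i_1<\dots<i_d\}$, $x_I=x_{i_1}\cdots x_{i_d}$. An integer multilinear $(n,d)$-form is a polynomial $\sum_{I\in\mathcal I_d(n)} f_I x_I$ with all $f_I\in\mathbb Z$. $F$ represents $b\in\mathbb Z$ if $F(\mathbf a)=b$ for some $\mathbf a\in\mathbb Z^n$. For $\mathbf a=(a_1,\dots,a_n)$, $|\mathbf a|=\max_i|a_i|$, and $|F|=\max_{I\in\mathcal I_d(n)}|f_I|$. -}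

module Defs where

open import Data.Nat as ℕ using (ℕ; zero; suc; _!; _⊔_; _≟_)
open import Data.Integer as ℤ using (ℤ)
open import Data.Fin using (Fin) renaming (zero to fzero; suc to fsuc)
open import Data.Fin.Subset using (Subset; inside; outside; ∣_∣)
open import Data.Vec using (_∷_; [])
open import Data.Bool using (if_then_else_)
open import Relation.Nullary.Decidable using (⌊_⌋)

sumSub : {n : ℕ} → (Subset n → ℤ) → ℤ
sumSub {zero}  g = g []
sumSub {suc n} g = sumSub (λ s → g (outside ∷ s)) ℤ.+ sumSub (λ s → g (inside ∷ s))

maxSub : {n : ℕ} → (Subset n → ℕ) → ℕ
maxSub {zero}  g = g []
maxSub {suc n} g = maxSub (λ s → g (outside ∷ s)) ⊔ maxSub (λ s → g (inside ∷ s))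

monomial : {n : ℕ} → Subset n → (Fin n → ℤ) → ℤ
monomial []             a = ℤ.1ℤ
monomial (inside  ∷ I) a = a fzero ℤ.* monomial I (λ i → a (fsuc i))
monomial (outside ∷ I) a = monomial I (λ i → a (fsuc i))

-- A multilinear (n,d)-form is given by its coefficient function f on subsets;
-- only the coefficients f I with |I| = d are used (I ∈ 𝓘_d(n)).
-- Evaluation F(a) = Σ_{I ∈ 𝓘_d(n)} f_I a_I.
evalForm : {n : ℕ} → ℕ → (Subset n → ℤ) → (Fin n → ℤ) → ℤ
evalForm d f a = sumSub (λ I → if ⌊ ∣ I ∣ ≟ d ⌋ then f I ℤ.* monomial I a else ℤ.0ℤ)

formHeight : {n : ℕ} → ℕ → (Subset n → ℤ) → ℕ
formHeight d f = maxSub (λ I → if ⌊ ∣ I ∣ ≟ d ⌋ then ℤ.∣ f I ∣ else 0)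

vecNorm : {n : ℕ} → (Fin n → ℤ) → ℕ
vecNorm {zero}  a = 0
vecNorm {suc n} a = ℤ.∣ a fzero ∣ ⊔ vecNorm (λ i → a (fsuc i))

-- eNum N = Σ_{k=0}^{N} N!/k!  = N! · S_N,  where S_N = Σ_{k≤N} 1/k! → e.
-- Computed as eNum 0 = 1, eNum (N+1) = (N+1)·eNum N + 1.
eNum : ℕ → ℕ
eNum zero    = 1
eNum (suc N) = suc N ℕ.* eNum N ℕ.+ 1

-- The rational p/q (q ≥ 1) satisfies p/q ≥ d!·e, i.e. p/q ≥ d!·S_N for all N,
-- i.e. d!·q·eNum N ≤ p·N! for all N.
AboveDFactE : ℕ → ℕ → ℕ → Set
AboveDFactE d p q = ∀ N → d ! ℕ.* q ℕ.* eNum N ℕ.≤ p ℕ.* N !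

-- A ≤ B · X^(d!·e), for naturals A, B, X (real exponent d!·e).
-- Since s ↦ X^s is continuous, this holds iff A ≤ B·X^s for every rational
-- s = p/q ≥ d!·e, i.e. A^q ≤ B^q · X^p.
LeEulerBound : ℕ → ℕ → ℕ → ℕ → Set
LeEulerBound A B X d =
  ∀ p q → 1 ℕ.≤ q → AboveDFactE d p q → A ℕ.^ q ℕ.≤ B ℕ.^ q ℕ.* X ℕ.^ p

{-# OPTIONS --safe #-}
module Submission where

-- Write F = x₀·G(x′) + H(x′), where x′ are the remaining variables, and induct on n.
-- Under (a): if H is coprime, solve H = b and put x₀ = 0.  Otherwise H has at most one
-- nonzero coefficient (two nonzero ones would be coprime), so |H(a′)| ≤ |F|·|a′|^d.  If G is
-- coprime, induction (or, for d = 1, G = ±1 being constant) gives G(a′) = ε = ±1, and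
-- x₀ = ε(b − H(a′)) solves F = b.  If neither is coprime, G = g·x_L and H = h·x_K with
-- gcd(g, h) = 1; choosing k ∈ K ∖ L and putting x₀ = u, x_k = v and all other variables 1
-- gives F = g u + h v, which is b by Bézout.  Under (b) with d ≥ 2, two d-subsets of [d+1]
-- share a coordinate i; splitting off x_i instead, G again has a coprime pair and H is a
-- single monomial; d = 1 falls under (a).
-- Each step turns a bound X^E(d−1) on a′ into |b|·X^E(d), where X = 2|F| and
-- E(d) = d·E(d−1) + 1 is eNum d ≤ d!·e.

open import Defs

open import Data.Bool using (Bool; true; false; if_then_else_)
open import Data.Fin using (Fin) renaming (zero to fzero; suc to fsuc)
open import Data.Fin.Subset using (Subset; inside; outside; ⊥; ⁅_⁆) renaming (∣_∣ to card)
open import Data.Fin.Subset.Properties using (anySubset?; ∣⊥∣≡0; ∣p∣≡n⇒p≡⊤)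
open import Data.Integer as ℤ using (ℤ; +_; -[1+_]; ∣_∣; 0ℤ; 1ℤ; _%ℕ_; _/ℕ_)
open import Data.Integer.DivMod using (a≡a%ℕn+[a/ℕn]*n; n%ℕd<d)
import Data.Integer.Properties as ℤ
open import Data.Integer.Tactic.RingSolver using (solve-∀)
open import Data.Nat as ℕ using (ℕ; zero; suc; _+_; _*_; _≤_; _<_; z≤n; s≤s; _!; _^_; _≟_)
import Data.Nat.Properties as ℕ
open import Data.Nat.Tactic.RingSolver using () renaming (solve-∀ to ℕ-solve-∀)
open import Data.Nat.Divisibility using (_∣_; ∣-refl; ∣-trans; _∣0; ∣1⇒≡1)
open import Data.Nat.GCD using (gcd; gcd[m,n]∣m; gcd[m,n]∣n; gcd-greatest; module Bézout)
open import Data.Nat.Coprimality as Coprime using (Coprime; coprime-Bézout; 0-coprimeTo-m⇒m≡1)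
open import Data.Product using (Σ; ∃-syntax; _×_; _,_)
open import Data.Sum using (_⊎_; inj₁; inj₂)
open import Data.Vec using (_∷_; []; lookup; insertAt; removeAt)
import Data.Vec.Properties as Vec
import Data.Vec.Functional as Vector
open import Function using (_∘_)
open import Relation.Binary.PropositionalEquality
open import Relation.Nullary using (¬_; Dec; yes; no; contradiction)
open import Relation.Nullary.Decidable
  using (⌊_⌋; isYes≗does; dec-true; dec-false; _×-dec_; ¬?; decidable-stable)

private
  variable
    n d : ℕ

-- Subsets

∣p∣≡0⇒p≡⊥ : (p : Subset n) → card p ≡ 0 → p ≡ ⊥
∣p∣≡0⇒p≡⊥ []            _      = refl
∣p∣≡0⇒p≡⊥ (outside ∷ p) ∣p∣≡0 = cong (outside ∷_) (∣p∣≡0⇒p≡⊥ p ∣p∣≡0)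

∣insertAt-inside∣ : (p : Subset n) (i : Fin (suc n)) → card (insertAt p i inside) ≡ suc (card p)
∣insertAt-inside∣ p             fzero    = refl
∣insertAt-inside∣ (outside ∷ p) (fsuc i) = ∣insertAt-inside∣ p i
∣insertAt-inside∣ (inside ∷ p)  (fsuc i) = cong suc (∣insertAt-inside∣ p i)

∣insertAt-outside∣ : (p : Subset n) (i : Fin (suc n)) → card (insertAt p i outside) ≡ card p
∣insertAt-outside∣ p             fzero    = refl
∣insertAt-outside∣ (outside ∷ p) (fsuc i) = ∣insertAt-outside∣ p i
∣insertAt-outside∣ (inside ∷ p)  (fsuc i) = cong suc (∣insertAt-outside∣ p i)

insertAt-injective : (i : Fin (suc n)) (x : Bool) {p q : Subset n} →
  insertAt p i x ≡ insertAt q i x → p ≡ q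
insertAt-injective i x {p} {q} eq = begin
  p                               ≡⟨ Vec.removeAt-insertAt p i x ⟨
  removeAt (insertAt p i x) i     ≡⟨ cong (λ s → removeAt s i) eq ⟩
  removeAt (insertAt q i x) i     ≡⟨ Vec.removeAt-insertAt q i x ⟩
  q                               ∎
  where open ≡-Reasoning

insertAt-inside≢insertAt-outside : (i : Fin (suc n)) (p q : Subset n) →
  insertAt p i inside ≢ insertAt q i outside
insertAt-inside≢insertAt-outside i p q eq with () ←
  trans (sym (Vec.insertAt-lookup p i inside))
        (trans (cong (λ s → lookup s i) eq) (Vec.insertAt-lookup q i outside))

insertAt-removeAt-inside : (p : Subset (suc n)) {i : Fin (suc n)} → lookup p i ≡ inside →
  insertAt (removeAt p i) i inside ≡ p
insertAt-removeAt-inside p {i} i∈p =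
  trans (cong (insertAt (removeAt p i) i) (sym i∈p)) (Vec.insertAt-removeAt p i)

∣q∣<∣p∣⇒∃[p∖q] : (p q : Subset n) → card q < card p →
  ∃[ k ] lookup p k ≡ inside × lookup q k ≡ outside
∣q∣<∣p∣⇒∃[p∖q] (inside ∷ p)  (outside ∷ q) _ = fzero , refl , refl
∣q∣<∣p∣⇒∃[p∖q] (inside ∷ p)  (inside ∷ q)  (s≤s lt)
  with k , k∈p , k∉q ← ∣q∣<∣p∣⇒∃[p∖q] p q lt = fsuc k , k∈p , k∉q
∣q∣<∣p∣⇒∃[p∖q] (outside ∷ p) (outside ∷ q) lt
  with k , k∈p , k∉q ← ∣q∣<∣p∣⇒∃[p∖q] p q lt = fsuc k , k∈p , k∉q
∣q∣<∣p∣⇒∃[p∖q] (outside ∷ p) (inside ∷ q)  lt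
  with k , k∈p , k∉q ← ∣q∣<∣p∣⇒∃[p∖q] p q (ℕ.<⇒≤ lt) = fsuc k , k∈p , k∉q

n<∣p∣+∣q∣⇒∃[p∩q] : (p q : Subset n) → n < card p + card q →
  ∃[ k ] lookup p k ≡ inside × lookup q k ≡ inside
n<∣p∣+∣q∣⇒∃[p∩q] []            []            ()
n<∣p∣+∣q∣⇒∃[p∩q] (inside ∷ p)  (inside ∷ q)  _ = fzero , refl , refl
n<∣p∣+∣q∣⇒∃[p∩q] (inside ∷ p)  (outside ∷ q) (s≤s lt)
  with k , k∈p , k∈q ← n<∣p∣+∣q∣⇒∃[p∩q] p q lt = fsuc k , k∈p , k∈q
n<∣p∣+∣q∣⇒∃[p∩q] {suc n} (outside ∷ p) (inside ∷ q) lt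
  with k , k∈p , k∈q
         ← n<∣p∣+∣q∣⇒∃[p∩q] p q (ℕ.s≤s⁻¹ (subst (suc n <_) (ℕ.+-suc (card p) (card q)) lt)) =
  fsuc k , k∈p , k∈q
n<∣p∣+∣q∣⇒∃[p∩q] (outside ∷ p) (outside ∷ q) lt
  with k , k∈p , k∈q ← n<∣p∣+∣q∣⇒∃[p∩q] p q (ℕ.<⇒≤ lt) = fsuc k , k∈p , k∈q

distinct-singletons-of-2 : (p q : Subset 2) → card p ≡ 1 → card q ≡ 1 → p ≢ q →
  (p ≡ ⁅ fzero ⁆ × q ≡ ⁅ fsuc fzero ⁆) ⊎ (p ≡ ⁅ fsuc fzero ⁆ × q ≡ ⁅ fzero ⁆)
distinct-singletons-of-2 (inside ∷ outside ∷ []) (outside ∷ inside ∷ []) _ _ _   = inj₁ (refl , refl)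
distinct-singletons-of-2 (outside ∷ inside ∷ []) (inside ∷ outside ∷ []) _ _ _   = inj₂ (refl , refl)
distinct-singletons-of-2 (inside ∷ outside ∷ []) (inside ∷ outside ∷ []) _ _ p≢q = contradiction refl p≢q
distinct-singletons-of-2 (outside ∷ inside ∷ []) (outside ∷ inside ∷ []) _ _ p≢q = contradiction refl p≢q
distinct-singletons-of-2 (inside ∷ inside ∷ [])   _ () _ _
distinct-singletons-of-2 (outside ∷ outside ∷ []) _ () _ _
distinct-singletons-of-2 _ (inside ∷ inside ∷ [])   _ () _
distinct-singletons-of-2 _ (outside ∷ outside ∷ []) _ () _

-- Sums, maxima and gcds over subsets

sumSub-cong : {g h : Subset n → ℤ} → (∀ s → g s ≡ h s) → sumSub g ≡ sumSub h
sumSub-cong {zero}  g≗h = g≗h []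
sumSub-cong {suc n} g≗h =
  cong₂ ℤ._+_ (sumSub-cong (g≗h ∘ (outside ∷_))) (sumSub-cong (g≗h ∘ (inside ∷_)))

sumSub-zero : {g : Subset n → ℤ} → (∀ s → g s ≡ 0ℤ) → sumSub g ≡ 0ℤ
sumSub-zero {zero}  g≗0 = g≗0 []
sumSub-zero {suc n} g≗0 =
  cong₂ ℤ._+_ (sumSub-zero (g≗0 ∘ (outside ∷_))) (sumSub-zero (g≗0 ∘ (inside ∷_)))

sumSub-*ˡ : (x : ℤ) (g : Subset n → ℤ) → sumSub (λ s → x ℤ.* g s) ≡ x ℤ.* sumSub g
sumSub-*ˡ {zero}  x g = refl
sumSub-*ˡ {suc n} x g =
  trans (cong₂ ℤ._+_ (sumSub-*ˡ x (g ∘ (outside ∷_))) (sumSub-*ˡ x (g ∘ (inside ∷_))))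
        (sym (ℤ.*-distribˡ-+ x (sumSub (g ∘ (outside ∷_))) (sumSub (g ∘ (inside ∷_)))))

sumSub-supported-at : {g : Subset n → ℤ} (p : Subset n) → (∀ s → s ≢ p → g s ≡ 0ℤ) →
  sumSub g ≡ g p
sumSub-supported-at []            _   = refl
sumSub-supported-at (outside ∷ p) g≡0 =
  trans (cong₂ ℤ._+_ (sumSub-supported-at p λ s s≢p → g≡0 (outside ∷ s) (s≢p ∘ Vec.∷-injectiveʳ))
                     (sumSub-zero λ s → g≡0 (inside ∷ s) λ ()))
        (ℤ.+-identityʳ _)
sumSub-supported-at (inside ∷ p)  g≡0 =
  trans (cong₂ ℤ._+_ (sumSub-zero λ s → g≡0 (outside ∷ s) λ ())
                     (sumSub-supported-at p λ s s≢p → g≡0 (inside ∷ s) (s≢p ∘ Vec.∷-injectiveʳ)))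
        (ℤ.+-identityˡ _)

sumSub-insertAt : (i : Fin (suc n)) (g : Subset (suc n) → ℤ) →
  sumSub g ≡ sumSub (λ s → g (insertAt s i outside)) ℤ.+ sumSub (λ s → g (insertAt s i inside))
sumSub-insertAt         fzero    g = refl
sumSub-insertAt {suc n} (fsuc i) g =
  trans (cong₂ ℤ._+_ (sumSub-insertAt i (g ∘ (outside ∷_))) (sumSub-insertAt i (g ∘ (inside ∷_))))
        (+-interchange (S outside outside) (S outside inside) (S inside outside) (S inside inside))
  where
  S : Bool → Bool → ℤ
  S x y = sumSub (λ s → g (x ∷ insertAt s i y))
  +-interchange : ∀ a b c e → (a ℤ.+ b) ℤ.+ (c ℤ.+ e) ≡ (a ℤ.+ c) ℤ.+ (b ℤ.+ e)
  +-interchange = solve-∀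

≤-maxSub : (g : Subset n → ℕ) (s : Subset n) → g s ≤ maxSub g
≤-maxSub g []            = ℕ.≤-refl
≤-maxSub g (outside ∷ s) = ℕ.≤-trans (≤-maxSub (g ∘ (outside ∷_)) s) (ℕ.m≤m⊔n _ _)
≤-maxSub g (inside ∷ s)  = ℕ.≤-trans (≤-maxSub (g ∘ (inside ∷_)) s) (ℕ.m≤n⊔m _ _)

maxSub-lub : (g : Subset n → ℕ) {B : ℕ} → (∀ s → g s ≤ B) → maxSub g ≤ B
maxSub-lub {zero}  g g≤B = g≤B []
maxSub-lub {suc n} g g≤B =
  ℕ.⊔-lub (maxSub-lub (g ∘ (outside ∷_)) (g≤B ∘ (outside ∷_)))
          (maxSub-lub (g ∘ (inside ∷_)) (g≤B ∘ (inside ∷_)))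

gcdSub : (Subset n → ℕ) → ℕ
gcdSub {zero}  g = g []
gcdSub {suc n} g = gcd (gcdSub (g ∘ (outside ∷_))) (gcdSub (g ∘ (inside ∷_)))

gcdSub∣ : (g : Subset n → ℕ) (s : Subset n) → gcdSub g ∣ g s
gcdSub∣ g []            = ∣-refl
gcdSub∣ g (outside ∷ s) = ∣-trans (gcd[m,n]∣m (gcdSub g₀) (gcdSub g₁)) (gcdSub∣ g₀ s)
  where
  g₀ = g ∘ (outside ∷_)
  g₁ = g ∘ (inside ∷_)
gcdSub∣ g (inside ∷ s)  = ∣-trans (gcd[m,n]∣n (gcdSub g₀) (gcdSub g₁)) (gcdSub∣ g₁ s)
  where
  g₀ = g ∘ (outside ∷_)
  g₁ = g ∘ (inside ∷_)

gcdSub-greatest : (g : Subset n → ℕ) {k : ℕ} → (∀ s → k ∣ g s) → k ∣ gcdSub g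
gcdSub-greatest {zero}  g k∣g = k∣g []
gcdSub-greatest {suc n} g k∣g =
  gcd-greatest (gcdSub-greatest (g ∘ (outside ∷_)) (k∣g ∘ (outside ∷_)))
               (gcdSub-greatest (g ∘ (inside ∷_)) (k∣g ∘ (inside ∷_)))

-- Evaluating forms

≤-vecNorm : (a : Fin n → ℤ) (j : Fin n) → ∣ a j ∣ ≤ vecNorm a
≤-vecNorm a fzero    = ℕ.m≤m⊔n _ _
≤-vecNorm a (fsuc j) = ℕ.≤-trans (≤-vecNorm (Vector.tail a) j) (ℕ.m≤n⊔m _ _)

vecNorm-lub : (a : Fin n → ℤ) {B : ℕ} → (∀ j → ∣ a j ∣ ≤ B) → vecNorm a ≤ B
vecNorm-lub {zero}  a _   = z≤n
vecNorm-lub {suc n} a a≤B = ℕ.⊔-lub (a≤B fzero) (vecNorm-lub (Vector.tail a) (a≤B ∘ fsuc))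

vecNorm-insertAt : (a : Fin n → ℤ) (i : Fin (suc n)) (x : ℤ) {B : ℕ} →
  ∣ x ∣ ≤ B → vecNorm a ≤ B → vecNorm (Vector.insertAt a i x) ≤ B
vecNorm-insertAt a fzero x x≤B a≤B =
  ℕ.⊔-lub x≤B (vecNorm-lub a λ j → ℕ.≤-trans (≤-vecNorm a j) a≤B)
vecNorm-insertAt {suc n} a (fsuc i) x x≤B a≤B =
  ℕ.⊔-lub (ℕ.≤-trans (≤-vecNorm a fzero) a≤B)
          (vecNorm-insertAt (Vector.tail a) i x x≤B (ℕ.≤-trans (ℕ.m≤n⊔m ∣ a fzero ∣ _) a≤B))

monomial-insertAt-inside : (p : Subset n) (i : Fin (suc n)) (a : Fin n → ℤ) (x : ℤ) →
  monomial (insertAt p i inside) (Vector.insertAt a i x) ≡ x ℤ.* monomial p a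
monomial-insertAt-inside p             fzero    a x = refl
monomial-insertAt-inside (outside ∷ p) (fsuc i) a x = monomial-insertAt-inside p i (Vector.tail a) x
monomial-insertAt-inside (inside ∷ p)  (fsuc i) a x =
  trans (cong (a fzero ℤ.*_) (monomial-insertAt-inside p i (Vector.tail a) x))
        (x*[y*z]≡y*[x*z] (a fzero) x (monomial p (Vector.tail a)))
  where
  x*[y*z]≡y*[x*z] : ∀ x y z → x ℤ.* (y ℤ.* z) ≡ y ℤ.* (x ℤ.* z)
  x*[y*z]≡y*[x*z] = solve-∀

monomial-insertAt-outside : (p : Subset n) (i : Fin (suc n)) (a : Fin n → ℤ) (x : ℤ) →
  monomial (insertAt p i outside) (Vector.insertAt a i x) ≡ monomial p a
monomial-insertAt-outside p             fzero    a x = refl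
monomial-insertAt-outside (outside ∷ p) (fsuc i) a x = monomial-insertAt-outside p i (Vector.tail a) x
monomial-insertAt-outside (inside ∷ p)  (fsuc i) a x =
  cong (a fzero ℤ.*_) (monomial-insertAt-outside p i (Vector.tail a) x)

∣monomial∣≤ : (p : Subset n) (a : Fin n → ℤ) → ∣ monomial p a ∣ ≤ vecNorm a ^ card p
∣monomial∣≤ []            a = ℕ.≤-refl
∣monomial∣≤ (outside ∷ p) a =
  ℕ.≤-trans (∣monomial∣≤ p (Vector.tail a)) (ℕ.^-monoˡ-≤ (card p) (ℕ.m≤n⊔m _ _))
∣monomial∣≤ (inside ∷ p)  a = begin
  ∣ a fzero ℤ.* monomial p a′ ∣     ≡⟨ ℤ.abs-* (a fzero) (monomial p a′) ⟩
  ∣ a fzero ∣ * ∣ monomial p a′ ∣   ≤⟨ ℕ.*-mono-≤ (≤-vecNorm a fzero) (∣monomial∣≤ p a′) ⟩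
  vecNorm a * vecNorm a′ ^ card p   ≤⟨ ℕ.*-monoʳ-≤ (vecNorm a) (ℕ.^-monoˡ-≤ (card p) (ℕ.m≤n⊔m _ _)) ⟩
  vecNorm a * vecNorm a ^ card p    ∎
  where
  open ℕ.≤-Reasoning
  a′ = Vector.tail a

monomial-⊥ : (a : Fin n → ℤ) → monomial ⊥ a ≡ 1ℤ
monomial-⊥ {zero}  a = refl
monomial-⊥ {suc n} a = monomial-⊥ (Vector.tail a)

monomial-1s : (p : Subset n) → monomial p (λ _ → 1ℤ) ≡ 1ℤ
monomial-1s []            = refl
monomial-1s (outside ∷ p) = monomial-1s p
monomial-1s (inside ∷ p)  = trans (ℤ.*-identityˡ _) (monomial-1s p)

monomial-insertAt-1s : (p : Subset (suc n)) (k : Fin (suc n)) (v : ℤ) →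
  monomial p (Vector.insertAt (λ _ → 1ℤ) k v) ≡ (if lookup p k then v else 1ℤ)
monomial-insertAt-1s         (outside ∷ p) fzero    v = monomial-1s p
monomial-insertAt-1s         (inside ∷ p)  fzero    v = trans (cong (v ℤ.*_) (monomial-1s p)) (ℤ.*-identityʳ v)
monomial-insertAt-1s {suc n} (outside ∷ p) (fsuc k) v = monomial-insertAt-1s p k v
monomial-insertAt-1s {suc n} (inside ∷ p)  (fsuc k) v = trans (ℤ.*-identityˡ _) (monomial-insertAt-1s p k v)

monomial-0s : (p : Subset n) → card p ≡ suc d → monomial p (λ _ → 0ℤ) ≡ 0ℤ
monomial-0s (outside ∷ p) ∣p∣≡1+d = monomial-0s p ∣p∣≡1+d
monomial-0s (inside ∷ p)  _       = refl

⌊≟⌋-true : {m d : ℕ} → m ≡ d → ⌊ m ≟ d ⌋ ≡ true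
⌊≟⌋-true {m} {d} m≡d = trans (isYes≗does (m ≟ d)) (dec-true (m ≟ d) m≡d)

⌊≟⌋-false : {m d : ℕ} → m ≢ d → ⌊ m ≟ d ⌋ ≡ false
⌊≟⌋-false {m} {d} m≢d = trans (isYes≗does (m ≟ d)) (dec-false (m ≟ d) m≢d)

⌊suc≟suc⌋ : (m d : ℕ) → ⌊ suc m ≟ suc d ⌋ ≡ ⌊ m ≟ d ⌋
⌊suc≟suc⌋ m d with m ≟ d
... | yes m≡d = ⌊≟⌋-true (cong suc m≡d)
... | no  m≢d = ⌊≟⌋-false (m≢d ∘ ℕ.suc-injective)

summand : ℕ → (Subset n → ℤ) → (Fin n → ℤ) → Subset n → ℤ
summand d f a p = if ⌊ card p ≟ d ⌋ then f p ℤ.* monomial p a else 0ℤ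

-- The coefficients of ∂F/∂xᵢ and of F|_{xᵢ = 0}, as forms in the variables other than xᵢ.
∂ : Fin (suc n) → (Subset (suc n) → ℤ) → Subset n → ℤ
∂ i f p = f (insertAt p i inside)

zeroAt : Fin (suc n) → (Subset (suc n) → ℤ) → Subset n → ℤ
zeroAt i f p = f (insertAt p i outside)

evalForm-insertAt : (f : Subset (suc n) → ℤ) (i : Fin (suc n)) (a : Fin n → ℤ) (x : ℤ) →
  evalForm (suc d) f (Vector.insertAt a i x) ≡
    x ℤ.* evalForm d (∂ i f) a ℤ.+ evalForm (suc d) (zeroAt i f) a
evalForm-insertAt {d = d} f i a x = begin
  evalForm (suc d) f xa
    ≡⟨ sumSub-insertAt i (summand (suc d) f xa) ⟩
  sumAt outside ℤ.+ sumAt inside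
    ≡⟨ ℤ.+-comm (sumAt outside) (sumAt inside) ⟩
  sumAt inside ℤ.+ sumAt outside
    ≡⟨ cong₂ ℤ._+_ (sumSub-cong inside-summand) (sumSub-cong outside-summand) ⟩
  sumSub (λ p → x ℤ.* summand d (∂ i f) a p) ℤ.+ evalForm (suc d) (zeroAt i f) a
    ≡⟨ cong (ℤ._+ _) (sumSub-*ˡ x (summand d (∂ i f) a)) ⟩
  x ℤ.* evalForm d (∂ i f) a ℤ.+ evalForm (suc d) (zeroAt i f) a ∎
  where
  open ≡-Reasoning
  xa = Vector.insertAt a i x
  sumAt : Bool → ℤ
  sumAt y = sumSub (λ p → summand (suc d) f xa (insertAt p i y))
  x*[y*z]≡y*[x*z] : ∀ x y z → x ℤ.* (y ℤ.* z) ≡ y ℤ.* (x ℤ.* z)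
  x*[y*z]≡y*[x*z] = solve-∀
  inside-summand : ∀ p → summand (suc d) f xa (insertAt p i inside) ≡ x ℤ.* summand d (∂ i f) a p
  inside-summand p
    rewrite ∣insertAt-inside∣ p i | ⌊suc≟suc⌋ (card p) d | monomial-insertAt-inside p i a x
    with ⌊ card p ≟ d ⌋
  ... | true  = x*[y*z]≡y*[x*z] (∂ i f p) x (monomial p a)
  ... | false = sym (ℤ.*-zeroʳ x)
  outside-summand : ∀ p → summand (suc d) f xa (insertAt p i outside) ≡ summand (suc d) (zeroAt i f) a p
  outside-summand p rewrite ∣insertAt-outside∣ p i | monomial-insertAt-outside p i a x = refl

Vanishes : ℕ → (Subset n → ℤ) → Set
Vanishes d f = ∀ p → card p ≡ d → f p ≡ 0ℤ

IsMonomialAt : ℕ → (Subset n → ℤ) → Subset n → Set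
IsMonomialAt d f p = ∀ q → card q ≡ d → q ≢ p → f q ≡ 0ℤ

evalForm-vanishing : (f : Subset n → ℤ) (a : Fin n → ℤ) → Vanishes d f → evalForm d f a ≡ 0ℤ
evalForm-vanishing {d = d} f a f≡0 = sumSub-zero summand≡0
  where
  summand≡0 : ∀ p → summand d f a p ≡ 0ℤ
  summand≡0 p with card p ≟ d
  ... | yes ∣p∣≡d = cong (ℤ._* monomial p a) (f≡0 p ∣p∣≡d)
  ... | no  _     = refl

evalForm-monomial : (f : Subset n → ℤ) (a : Fin n → ℤ) {p : Subset n} → card p ≡ d →
  IsMonomialAt d f p → evalForm d f a ≡ f p ℤ.* monomial p a
evalForm-monomial {d = d} f a {p} ∣p∣≡d only-p = begin
  sumSub (summand d f a)  ≡⟨ sumSub-supported-at p summand≡0 ⟩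
  summand d f a p         ≡⟨ cong (if_then f p ℤ.* monomial p a else 0ℤ) (⌊≟⌋-true ∣p∣≡d) ⟩
  f p ℤ.* monomial p a    ∎
  where
  open ≡-Reasoning
  summand≡0 : ∀ q → q ≢ p → summand d f a q ≡ 0ℤ
  summand≡0 q q≢p with card q ≟ d
  ... | yes ∣q∣≡d = cong (ℤ._* monomial q a) (only-p q ∣q∣≡d q≢p)
  ... | no  _     = refl

evalForm-degree-0 : (f : Subset n → ℤ) (a : Fin n → ℤ) → evalForm 0 f a ≡ f ⊥
evalForm-degree-0 {n} f a = begin
  evalForm 0 f a        ≡⟨ evalForm-monomial f a (∣⊥∣≡0 n) only-⊥ ⟩
  f ⊥ ℤ.* monomial ⊥ a  ≡⟨ cong (f ⊥ ℤ.*_) (monomial-⊥ a) ⟩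
  f ⊥ ℤ.* 1ℤ            ≡⟨ ℤ.*-identityʳ (f ⊥) ⟩
  f ⊥                   ∎
  where
  open ≡-Reasoning
  only-⊥ : IsMonomialAt 0 f ⊥
  only-⊥ q ∣q∣≡0 q≢⊥ = contradiction (∣p∣≡0⇒p≡⊥ q ∣q∣≡0) q≢⊥

evalForm-0s : (f : Subset n → ℤ) → evalForm (suc d) f (λ _ → 0ℤ) ≡ 0ℤ
evalForm-0s {d = d} f = sumSub-zero summand≡0
  where
  summand≡0 : ∀ p → summand (suc d) f (λ _ → 0ℤ) p ≡ 0ℤ
  summand≡0 p with card p ≟ suc d
  ... | yes ∣p∣≡1+d = trans (cong (f p ℤ.*_) (monomial-0s p ∣p∣≡1+d)) (ℤ.*-zeroʳ (f p))
  ... | no  _       = refl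

-- Heights and conditions on the coefficients

coeffAbs : ℕ → (Subset n → ℤ) → Subset n → ℕ
coeffAbs d f p = if ⌊ card p ≟ d ⌋ then ∣ f p ∣ else 0

coeffAbs-≡ : (f : Subset n → ℤ) {p : Subset n} → card p ≡ d → coeffAbs d f p ≡ ∣ f p ∣
coeffAbs-≡ f {p} ∣p∣≡d = cong (if_then ∣ f p ∣ else 0) (⌊≟⌋-true ∣p∣≡d)

≤-formHeight : (f : Subset n → ℤ) {p : Subset n} → card p ≡ d → ∣ f p ∣ ≤ formHeight d f
≤-formHeight {d = d} f {p} ∣p∣≡d =
  subst (_≤ formHeight d f) (coeffAbs-≡ f ∣p∣≡d) (≤-maxSub (coeffAbs d f) p)

formHeight-lub : (f : Subset n → ℤ) {B : ℕ} → (∀ p → card p ≡ d → ∣ f p ∣ ≤ B) → formHeight d f ≤ B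
formHeight-lub {d = d} f {B} f≤B = maxSub-lub (coeffAbs d f) coeffAbs≤B
  where
  coeffAbs≤B : ∀ p → coeffAbs d f p ≤ B
  coeffAbs≤B p with card p ≟ d
  ... | yes ∣p∣≡d = f≤B p ∣p∣≡d
  ... | no  _     = z≤n

formHeight-∂ : (f : Subset (suc n) → ℤ) (i : Fin (suc n)) → formHeight d (∂ i f) ≤ formHeight (suc d) f
formHeight-∂ f i = formHeight-lub (∂ i f) λ p ∣p∣≡d →
  ≤-formHeight f (trans (∣insertAt-inside∣ p i) (cong suc ∣p∣≡d))

formHeight-zeroAt : (f : Subset (suc n) → ℤ) (i : Fin (suc n)) → formHeight d (zeroAt i f) ≤ formHeight d f
formHeight-zeroAt f i = formHeight-lub (zeroAt i f) λ p ∣p∣≡d →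
  ≤-formHeight f (trans (∣insertAt-outside∣ p i) ∣p∣≡d)

DividesCoeffs : ℕ → (Subset n → ℤ) → ℕ → Set
DividesCoeffs d f k = ∀ p → card p ≡ d → k ∣ ∣ f p ∣

IsCoprimeForm : ℕ → (Subset n → ℤ) → Set
IsCoprimeForm d f = ∀ k → DividesCoeffs d f k → k ≡ 1

PairwiseCoprimeCoeffs : ℕ → (Subset n → ℤ) → Set
PairwiseCoprimeCoeffs d f = ∀ p q → card p ≡ d → card q ≡ d → p ≢ q →
  f p ≢ 0ℤ → f q ≢ 0ℤ → Coprime ∣ f p ∣ ∣ f q ∣

AtMostOneNonzero : ℕ → (Subset n → ℤ) → Set
AtMostOneNonzero d f = ∀ p q → card p ≡ d → card q ≡ d → p ≢ q → f p ≡ 0ℤ ⊎ f q ≡ 0ℤ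

isCoprimeForm? : (d : ℕ) (f : Subset n → ℤ) → Dec (IsCoprimeForm d f)
isCoprimeForm? d f with gcdSub (coeffAbs d f) ≟ 1
... | yes gcd≡1 = yes λ k k∣f →
  ∣1⇒≡1 (subst (k ∣_) gcd≡1 (gcdSub-greatest (coeffAbs d f) (∣coeffAbs k∣f)))
  where
  ∣coeffAbs : ∀ {k} → DividesCoeffs d f k → ∀ p → k ∣ coeffAbs d f p
  ∣coeffAbs k∣f p with card p ≟ d
  ... | yes ∣p∣≡d = k∣f p ∣p∣≡d
  ... | no  _     = _ ∣0
... | no  gcd≢1 = no λ coprime → gcd≢1 (coprime _ gcd∣coeffs)
  where
  gcd∣coeffs : DividesCoeffs d f (gcdSub (coeffAbs d f))
  gcd∣coeffs p ∣p∣≡d = subst (_ ∣_) (coeffAbs-≡ f ∣p∣≡d) (gcdSub∣ (coeffAbs d f) p)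

nonzeroCoeff-or-vanishes : (d : ℕ) (f : Subset n → ℤ) → (∃[ p ] card p ≡ d × f p ≢ 0ℤ) ⊎ Vanishes d f
nonzeroCoeff-or-vanishes d f with anySubset? (λ p → card p ≟ d ×-dec ¬? (f p ℤ.≟ 0ℤ))
... | yes nonzero = inj₁ nonzero
... | no  none    = inj₂ λ p ∣p∣≡d → decidable-stable (f p ℤ.≟ 0ℤ) λ fp≢0 → none (p , ∣p∣≡d , fp≢0)

vanishing⇒dividesCoeffs : {f : Subset n → ℤ} → Vanishes d f → ∀ k → DividesCoeffs d f k
vanishing⇒dividesCoeffs f≡0 k p ∣p∣≡d = subst (λ x → k ∣ ∣ x ∣) (sym (f≡0 p ∣p∣≡d)) (k ∣0)

coprimeForm⇒nonzeroCoeff : (f : Subset n → ℤ) → IsCoprimeForm d f → ∃[ p ] card p ≡ d × f p ≢ 0ℤ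
coprimeForm⇒nonzeroCoeff {d = d} f coprime with nonzeroCoeff-or-vanishes d f
... | inj₁ nonzero = nonzero
... | inj₂ f≡0 with () ← coprime 0 (vanishing⇒dividesCoeffs f≡0 0)

coprimeForm⇒1≤formHeight : (f : Subset n → ℤ) → IsCoprimeForm d f → 1 ≤ formHeight d f
coprimeForm⇒1≤formHeight f coprime with p , ∣p∣≡d , fp≢0 ← coprimeForm⇒nonzeroCoeff f coprime =
  ℕ.≤-trans (ℕ.n≢0⇒n>0 (fp≢0 ∘ ℤ.∣i∣≡0⇒i≡0)) (≤-formHeight f ∣p∣≡d)

coprimeForm-degree-0 : (f : Subset n → ℤ) → IsCoprimeForm 0 f → ∣ f ⊥ ∣ ≡ 1
coprimeForm-degree-0 f coprime =
  coprime ∣ f ⊥ ∣ λ p ∣p∣≡0 →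
    subst (λ q → ∣ f ⊥ ∣ ∣ ∣ f q ∣) (sym (∣p∣≡0⇒p≡⊥ p ∣p∣≡0)) ∣-refl

coprimePair⇒coprimeForm : (f : Subset n → ℤ) {p q : Subset n} → card p ≡ d → card q ≡ d →
  Coprime ∣ f p ∣ ∣ f q ∣ → IsCoprimeForm d f
coprimePair⇒coprimeForm f {p} {q} ∣p∣≡d ∣q∣≡d coprime k k∣f = coprime (k∣f p ∣p∣≡d , k∣f q ∣q∣≡d)

dividesCoeffs-join : (i : Fin (suc n)) (f : Subset (suc n) → ℤ) {k : ℕ} →
  DividesCoeffs d (∂ i f) k → DividesCoeffs (suc d) (zeroAt i f) k → DividesCoeffs (suc d) f k
dividesCoeffs-join i f k∣∂ k∣zeroAt p ∣p∣≡1+d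
  with removeAt p i | lookup p i | Vec.insertAt-removeAt p i
... | p′ | inside  | refl = k∣∂ p′ (ℕ.suc-injective (trans (sym (∣insertAt-inside∣ p′ i)) ∣p∣≡1+d))
... | p′ | outside | refl = k∣zeroAt p′ (trans (sym (∣insertAt-outside∣ p′ i)) ∣p∣≡1+d)

coprime-∂-of-zeroAt-vanishing : (i : Fin (suc n)) (f : Subset (suc n) → ℤ) →
  IsCoprimeForm (suc d) f → Vanishes (suc d) (zeroAt i f) → IsCoprimeForm d (∂ i f)
coprime-∂-of-zeroAt-vanishing i f coprime zeroAt≡0 k k∣∂ =
  coprime k (dividesCoeffs-join i f k∣∂ (vanishing⇒dividesCoeffs zeroAt≡0 k))

coprime-zeroAt-of-∂-vanishing : (i : Fin (suc n)) (f : Subset (suc n) → ℤ) →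
  IsCoprimeForm (suc d) f → Vanishes d (∂ i f) → IsCoprimeForm (suc d) (zeroAt i f)
coprime-zeroAt-of-∂-vanishing i f coprime ∂≡0 k k∣zeroAt =
  coprime k (dividesCoeffs-join i f (vanishing⇒dividesCoeffs ∂≡0 k) k∣zeroAt)

pairwiseCoprime-∂ : (i : Fin (suc n)) {f : Subset (suc n) → ℤ} →
  PairwiseCoprimeCoeffs (suc d) f → PairwiseCoprimeCoeffs d (∂ i f)
pairwiseCoprime-∂ i pairwise p q ∣p∣≡d ∣q∣≡d p≢q =
  pairwise _ _ (trans (∣insertAt-inside∣ p i) (cong suc ∣p∣≡d))
               (trans (∣insertAt-inside∣ q i) (cong suc ∣q∣≡d))
               (p≢q ∘ insertAt-injective i inside)

pairwiseCoprime-zeroAt : (i : Fin (suc n)) {f : Subset (suc n) → ℤ} →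
  PairwiseCoprimeCoeffs d f → PairwiseCoprimeCoeffs d (zeroAt i f)
pairwiseCoprime-zeroAt i pairwise p q ∣p∣≡d ∣q∣≡d p≢q =
  pairwise _ _ (trans (∣insertAt-outside∣ p i) ∣p∣≡d) (trans (∣insertAt-outside∣ q i) ∣q∣≡d)
               (p≢q ∘ insertAt-injective i outside)

pairwiseCoprime-binary-linear : (f : Subset 2 → ℤ) {p q : Subset 2} →
  card p ≡ 1 → card q ≡ 1 → p ≢ q → Coprime ∣ f p ∣ ∣ f q ∣ → PairwiseCoprimeCoeffs 1 f
pairwiseCoprime-binary-linear f {p} {q} ∣p∣≡1 ∣q∣≡1 p≢q coprime-pq = pairwise
  where
  coprime-01 : Coprime ∣ f ⁅ fzero ⁆ ∣ ∣ f ⁅ fsuc fzero ⁆ ∣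
  coprime-01 with distinct-singletons-of-2 p q ∣p∣≡1 ∣q∣≡1 p≢q
  ... | inj₁ (refl , refl) = coprime-pq
  ... | inj₂ (refl , refl) = Coprime.sym coprime-pq
  pairwise : PairwiseCoprimeCoeffs 1 f
  pairwise p′ q′ ∣p′∣≡1 ∣q′∣≡1 p′≢q′ _ _ with distinct-singletons-of-2 p′ q′ ∣p′∣≡1 ∣q′∣≡1 p′≢q′
  ... | inj₁ (refl , refl) = coprime-01
  ... | inj₂ (refl , refl) = Coprime.sym coprime-01

coprimePair-∂ : (f : Subset (suc n) → ℤ) (i : Fin (suc n)) {p q : Subset (suc n)} →
  lookup p i ≡ inside → lookup q i ≡ inside → card p ≡ suc d → card q ≡ suc d → p ≢ q →
  Coprime ∣ f p ∣ ∣ f q ∣ →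
  ∃[ p′ ] ∃[ q′ ] card p′ ≡ d × card q′ ≡ d × p′ ≢ q′ × Coprime ∣ ∂ i f p′ ∣ ∣ ∂ i f q′ ∣
coprimePair-∂ f i {p} {q} i∈p i∈q ∣p∣≡1+d ∣q∣≡1+d p≢q coprime
  with removeAt p i | insertAt-removeAt-inside p i∈p | removeAt q i | insertAt-removeAt-inside q i∈q
... | p′ | refl | q′ | refl =
  p′ , q′ ,
  ℕ.suc-injective (trans (sym (∣insertAt-inside∣ p′ i)) ∣p∣≡1+d) ,
  ℕ.suc-injective (trans (sym (∣insertAt-inside∣ q′ i)) ∣q∣≡1+d) ,
  (λ p′≡q′ → p≢q (cong (λ s → insertAt s i inside) p′≡q′)) ,
  coprime

¬coprime⇒atMostOneNonzero : {f : Subset n → ℤ} →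
  PairwiseCoprimeCoeffs d f → ¬ IsCoprimeForm d f → AtMostOneNonzero d f
¬coprime⇒atMostOneNonzero {f = f} pairwise ¬coprime p q ∣p∣≡d ∣q∣≡d p≢q
  with f p ℤ.≟ 0ℤ | f q ℤ.≟ 0ℤ
... | yes fp≡0 | _        = inj₁ fp≡0
... | no  _    | yes fq≡0 = inj₂ fq≡0
... | no fp≢0  | no fq≢0  = contradiction (coprimePair⇒coprimeForm f ∣p∣≡d ∣q∣≡d coprime) ¬coprime
  where coprime = pairwise p q ∣p∣≡d ∣q∣≡d p≢q fp≢0 fq≢0

atMostOneNonzero-full : (f : Subset n → ℤ) → AtMostOneNonzero n f
atMostOneNonzero-full f p q ∣p∣≡n ∣q∣≡n p≢q =
  contradiction (trans (∣p∣≡n⇒p≡⊤ ∣p∣≡n) (sym (∣p∣≡n⇒p≡⊤ ∣q∣≡n))) p≢q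

atMostOneNonzero⇒monomialAt : {f : Subset n → ℤ} → AtMostOneNonzero d f →
  {p : Subset n} → card p ≡ d → f p ≢ 0ℤ → IsMonomialAt d f p
atMostOneNonzero⇒monomialAt atMostOne ∣p∣≡d fp≢0 q ∣q∣≡d q≢p with atMostOne q _ ∣q∣≡d ∣p∣≡d q≢p
... | inj₁ fq≡0 = fq≡0
... | inj₂ fp≡0 = contradiction fp≡0 fp≢0

∣evalForm∣≤ : (f : Subset n → ℤ) (a : Fin n → ℤ) → AtMostOneNonzero d f →
  ∣ evalForm d f a ∣ ≤ formHeight d f * vecNorm a ^ d
∣evalForm∣≤ {d = d} f a atMostOne with nonzeroCoeff-or-vanishes d f
... | inj₂ f≡0 = ℕ.≤-trans (ℕ.≤-reflexive (cong ∣_∣ (evalForm-vanishing f a f≡0))) z≤n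
... | inj₁ (p , ∣p∣≡d , fp≢0) = begin
  ∣ evalForm d f a ∣                   ≡⟨ cong ∣_∣ (evalForm-monomial f a ∣p∣≡d only-p) ⟩
  ∣ f p ℤ.* monomial p a ∣             ≡⟨ ℤ.abs-* (f p) (monomial p a) ⟩
  ∣ f p ∣ * ∣ monomial p a ∣           ≤⟨ ℕ.*-mono-≤ (≤-formHeight f ∣p∣≡d) (∣monomial∣≤ p a) ⟩
  formHeight d f * vecNorm a ^ card p  ≡⟨ cong (λ e → formHeight d f * vecNorm a ^ e) ∣p∣≡d ⟩
  formHeight d f * vecNorm a ^ d       ∎
  where
  open ℕ.≤-Reasoning
  only-p = atMostOneNonzero⇒monomialAt atMostOne ∣p∣≡d fp≢0

-- Bézout's identity with bounded coefficients

ℕ-identity⇒ℤ : {a b c e : ℕ} → 1 + a * b ≡ c * e → + c ℤ.* + e ℤ.- + a ℤ.* + b ≡ 1ℤ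
ℕ-identity⇒ℤ {a} {b} {c} {e} 1+ab≡ce = begin
  + c ℤ.* + e ℤ.- + a ℤ.* + b         ≡⟨ cong₂ ℤ._-_ (ℤ.pos-* c e) (ℤ.pos-* a b) ⟨
  + (c * e) ℤ.- + (a * b)             ≡⟨ cong (λ t → + t ℤ.- + (a * b)) 1+ab≡ce ⟨
  1ℤ ℤ.+ + (a * b) ℤ.- + (a * b)      ≡⟨ [1+x]-x≡1 (+ (a * b)) ⟩
  1ℤ                                  ∎
  where
  open ≡-Reasoning
  [1+x]-x≡1 : ∀ x → 1ℤ ℤ.+ x ℤ.- x ≡ 1ℤ
  [1+x]-x≡1 = solve-∀

bézout : {M N : ℕ} → Coprime M N → ∃[ u ] ∃[ v ] + M ℤ.* u ℤ.+ + N ℤ.* v ≡ 1ℤ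
bézout {M} {N} coprime with coprime-Bézout coprime
... | Bézout.+- x y 1+yN≡xM =
  + x , ℤ.- + y , trans (rearrange (+ M) (+ N) (+ x) (+ y)) (ℕ-identity⇒ℤ {y} {N} {x} {M} 1+yN≡xM)
  where
  rearrange : ∀ m n x y → m ℤ.* x ℤ.+ n ℤ.* ℤ.- y ≡ x ℤ.* m ℤ.- y ℤ.* n
  rearrange = solve-∀
... | Bézout.-+ x y 1+xM≡yN =
  ℤ.- + x , + y , trans (rearrange (+ M) (+ N) (+ x) (+ y)) (ℕ-identity⇒ℤ {x} {M} {y} {N} 1+xM≡yN)
  where
  rearrange : ∀ m n x y → m ℤ.* ℤ.- x ℤ.+ n ℤ.* y ≡ y ℤ.* n ℤ.- x ℤ.* m
  rearrange = solve-∀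

bézout-reduce : {M N : ℕ} .{{_ : ℕ.NonZero N}} {u v : ℤ} → + M ℤ.* u ℤ.+ + N ℤ.* v ≡ 1ℤ →
  ∃[ u′ ] ∃[ v′ ] + M ℤ.* u′ ℤ.+ + N ℤ.* v′ ≡ 1ℤ × ∣ u′ ∣ < N
bézout-reduce {M} {N} {u} {v} Mu+Nv≡1 = + r , v ℤ.+ q ℤ.* + M , Mr+N[v+qM]≡1 , n%ℕd<d u N
  where
  open ≡-Reasoning
  r = u %ℕ N
  q = u /ℕ N
  u≡r+qN : u ≡ + r ℤ.+ q ℤ.* + N
  u≡r+qN = a≡a%ℕn+[a/ℕn]*n u N
  rearrange : ∀ m n r q v → m ℤ.* r ℤ.+ n ℤ.* (v ℤ.+ q ℤ.* m) ≡ m ℤ.* (r ℤ.+ q ℤ.* n) ℤ.+ n ℤ.* v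
  rearrange = solve-∀
  Mr+N[v+qM]≡1 : + M ℤ.* + r ℤ.+ + N ℤ.* (v ℤ.+ q ℤ.* + M) ≡ 1ℤ
  Mr+N[v+qM]≡1 = begin
    + M ℤ.* + r ℤ.+ + N ℤ.* (v ℤ.+ q ℤ.* + M)  ≡⟨ rearrange (+ M) (+ N) (+ r) q v ⟩
    + M ℤ.* (+ r ℤ.+ q ℤ.* + N) ℤ.+ + N ℤ.* v  ≡⟨ cong (λ t → + M ℤ.* t ℤ.+ + N ℤ.* v) u≡r+qN ⟨
    + M ℤ.* u ℤ.+ + N ℤ.* v                    ≡⟨ Mu+Nv≡1 ⟩
    1ℤ                                         ∎

bézout-bound : {M N : ℕ} {u v : ℤ} → + M ℤ.* u ℤ.+ + N ℤ.* v ≡ 1ℤ →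
  ∣ u ∣ ≤ N → 1 ≤ N → ∣ v ∣ ≤ suc M
bézout-bound {M} {N} {u} {v} Mu+Nv≡1 u≤N 1≤N = ℕ.*-cancelˡ-≤ N {{ℕ.>-nonZero 1≤N}} (begin
  N * ∣ v ∣               ≡⟨ ℤ.abs-* (+ N) v ⟨
  ∣ + N ℤ.* v ∣           ≡⟨ cong ∣_∣ Nv≡1-Mu ⟩
  ∣ 1ℤ ℤ.- + M ℤ.* u ∣    ≤⟨ ℤ.∣i-j∣≤∣i∣+∣j∣ 1ℤ (+ M ℤ.* u) ⟩
  1 + ∣ + M ℤ.* u ∣       ≡⟨ cong suc (ℤ.abs-* (+ M) u) ⟩
  1 + M * ∣ u ∣           ≤⟨ ℕ.+-mono-≤ 1≤N (ℕ.*-monoʳ-≤ M u≤N) ⟩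
  N + M * N               ≡⟨ cong (_+_ N) (ℕ.*-comm M N) ⟩
  N + N * M               ≡⟨ ℕ.*-suc N M ⟨
  N * suc M               ∎)
  where
  open ℕ.≤-Reasoning
  isolate : ∀ x y → (x ℤ.+ y) ℤ.- x ≡ y
  isolate = solve-∀
  Nv≡1-Mu : + N ℤ.* v ≡ 1ℤ ℤ.- + M ℤ.* u
  Nv≡1-Mu = trans (sym (isolate (+ M ℤ.* u) (+ N ℤ.* v))) (cong (ℤ._- + M ℤ.* u) Mu+Nv≡1)

bézout-bounded : {M N : ℕ} → Coprime M N →
  ∃[ u ] ∃[ v ] + M ℤ.* u ℤ.+ + N ℤ.* v ≡ 1ℤ × ∣ u ∣ ≤ M + N × ∣ v ∣ ≤ M + N
bézout-bounded {M} {zero} coprime with refl ← 0-coprimeTo-m⇒m≡1 (Coprime.sym coprime) =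
  1ℤ , 0ℤ , refl , ℕ.≤-refl , z≤n
bézout-bounded {M} {suc N} coprime
  with u , v , Mu+Nv≡1 ← bézout coprime
  with u′ , v′ , Mu′+Nv′≡1 , u′<N ← bézout-reduce {M} {suc N} {u} {v} Mu+Nv≡1 =
  u′ , v′ , Mu′+Nv′≡1 ,
  ℕ.≤-trans (ℕ.<⇒≤ u′<N) (ℕ.m≤n+m (suc N) M) ,
  ℕ.≤-trans (bézout-bound {M} {suc N} {u′} {v′} Mu′+Nv′≡1 (ℕ.<⇒≤ u′<N) (s≤s z≤n))
            (ℕ.≤-trans (s≤s (ℕ.m≤m+n M N)) (ℕ.≤-reflexive (sym (ℕ.+-suc M N))))

∃[ε]-i*ε≡∣i∣ : (i : ℤ) → ∃[ ε ] i ℤ.* ε ≡ + ∣ i ∣ × ∣ ε ∣ ≡ 1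
∃[ε]-i*ε≡∣i∣ (+ k)    = 1ℤ , ℤ.*-identityʳ (+ k) , refl
∃[ε]-i*ε≡∣i∣ -[1+ k ] = ℤ.-1ℤ , trans (ℤ.*-comm -[1+ k ] ℤ.-1ℤ) (ℤ.-1*i≡-i -[1+ k ]) , refl

bézout-scaled : (m n : ℤ) → Coprime ∣ m ∣ ∣ n ∣ → (b : ℤ) →
  ∃[ u ] ∃[ v ] m ℤ.* u ℤ.+ n ℤ.* v ≡ b ×
                ∣ u ∣ ≤ ∣ b ∣ * (∣ m ∣ + ∣ n ∣) × ∣ v ∣ ≤ ∣ b ∣ * (∣ m ∣ + ∣ n ∣)
bézout-scaled m n coprime b
  with u , v , Mu+Nv≡1 , u≤M+N , v≤M+N ← bézout-bounded coprime
  with s , ms≡∣m∣ , ∣s∣≡1 ← ∃[ε]-i*ε≡∣i∣ m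
  with t , nt≡∣n∣ , ∣t∣≡1 ← ∃[ε]-i*ε≡∣i∣ n =
  s ℤ.* (u ℤ.* b) , t ℤ.* (v ℤ.* b) , equation , bound s u ∣s∣≡1 u≤M+N , bound t v ∣t∣≡1 v≤M+N
  where
  rearrange : ∀ m n s t u v b →
    m ℤ.* (s ℤ.* (u ℤ.* b)) ℤ.+ n ℤ.* (t ℤ.* (v ℤ.* b)) ≡
      ((m ℤ.* s) ℤ.* u ℤ.+ (n ℤ.* t) ℤ.* v) ℤ.* b
  rearrange = solve-∀
  equation : m ℤ.* (s ℤ.* (u ℤ.* b)) ℤ.+ n ℤ.* (t ℤ.* (v ℤ.* b)) ≡ b
  equation = begin
    m ℤ.* (s ℤ.* (u ℤ.* b)) ℤ.+ n ℤ.* (t ℤ.* (v ℤ.* b))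
      ≡⟨ rearrange m n s t u v b ⟩
    ((m ℤ.* s) ℤ.* u ℤ.+ (n ℤ.* t) ℤ.* v) ℤ.* b
      ≡⟨ cong₂ (λ x y → (x ℤ.* u ℤ.+ y ℤ.* v) ℤ.* b) ms≡∣m∣ nt≡∣n∣ ⟩
    (+ ∣ m ∣ ℤ.* u ℤ.+ + ∣ n ∣ ℤ.* v) ℤ.* b
      ≡⟨ cong (ℤ._* b) Mu+Nv≡1 ⟩
    1ℤ ℤ.* b
      ≡⟨ ℤ.*-identityˡ b ⟩
    b ∎
    where open ≡-Reasoning
  bound : ∀ ε w → ∣ ε ∣ ≡ 1 → ∣ w ∣ ≤ ∣ m ∣ + ∣ n ∣ →
    ∣ ε ℤ.* (w ℤ.* b) ∣ ≤ ∣ b ∣ * (∣ m ∣ + ∣ n ∣)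
  bound ε w ∣ε∣≡1 w≤M+N = begin
    ∣ ε ℤ.* (w ℤ.* b) ∣        ≡⟨ ℤ.abs-* ε (w ℤ.* b) ⟩
    ∣ ε ∣ * ∣ w ℤ.* b ∣        ≡⟨ cong (_* ∣ w ℤ.* b ∣) ∣ε∣≡1 ⟩
    1 * ∣ w ℤ.* b ∣            ≡⟨ ℕ.*-identityˡ _ ⟩
    ∣ w ℤ.* b ∣                ≡⟨ ℤ.abs-* w b ⟩
    ∣ w ∣ * ∣ b ∣              ≡⟨ ℕ.*-comm ∣ w ∣ ∣ b ∣ ⟩
    ∣ b ∣ * ∣ w ∣              ≤⟨ ℕ.*-monoʳ-≤ ∣ b ∣ w≤M+N ⟩
    ∣ b ∣ * (∣ m ∣ + ∣ n ∣)    ∎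
    where open ℕ.≤-Reasoning

-- Representing integers

1≤∣i∣ : {i : ℤ} → i ≢ 0ℤ → 1 ≤ ∣ i ∣
1≤∣i∣ i≢0 = ℕ.n≢0⇒n>0 (i≢0 ∘ ℤ.∣i∣≡0⇒i≡0)

1≤2* : {h : ℕ} → 1 ≤ h → 1 ≤ 2 * h
1≤2* 1≤h = ℕ.≤-trans 1≤h (ℕ.m≤m+n _ _)

∣i∣≡1⇒i*i≡1 : (ε : ℤ) → ∣ ε ∣ ≡ 1 → ε ℤ.* ε ≡ 1ℤ
∣i∣≡1⇒i*i≡1 (+ 1)           _ = refl
∣i∣≡1⇒i*i≡1 -[1+ 0 ]        _ = refl
∣i∣≡1⇒i*i≡1 (+ 0)           ()
∣i∣≡1⇒i*i≡1 (+ suc (suc _)) ()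
∣i∣≡1⇒i*i≡1 -[1+ suc _ ]    ()

1≤eNum : (d : ℕ) → 1 ≤ eNum d
1≤eNum zero    = ℕ.≤-refl
1≤eNum (suc d) = ℕ.m≤n+m 1 (suc d * eNum d)

^-eNum-mono : {X : ℕ} → 1 ≤ X → (d : ℕ) → X ^ eNum d ≤ X ^ eNum (suc d)
^-eNum-mono {X} 1≤X d = ℕ.^-monoʳ-≤ X {{ℕ.>-nonZero 1≤X}}
  (ℕ.≤-trans (ℕ.m≤m+n (eNum d) (d * eNum d)) (ℕ.m≤m+n _ 1))

^-mono-formHeight : {h h′ : ℕ} (e : ℕ) → h ≤ h′ → (2 * h) ^ e ≤ (2 * h′) ^ e
^-mono-formHeight e h≤h′ = ℕ.^-monoˡ-≤ e (ℕ.*-monoʳ-≤ 2 h≤h′)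

-- The recursion eNum (suc d) = suc d * eNum d + 1 is exactly the cost of one step
-- x = ε·(b − H(a)) with |H(a)| ≤ h·|a|^(suc d).
eNum-step : {B h Y : ℕ} → 1 ≤ B → 1 ≤ h → Y ≤ (2 * h) ^ eNum d →
  B + h * Y ^ suc d ≤ B * (2 * h) ^ eNum (suc d)
eNum-step {d} {B} {h} {Y} 1≤B 1≤h Y≤X^E = begin
  B + h * Y ^ suc d           ≤⟨ ℕ.+-monoʳ-≤ B (ℕ.*-monoʳ-≤ h Y^[1+d]≤Z) ⟩
  B + h * Z                   ≤⟨ ℕ.+-mono-≤ (ℕ.m≤m*n B (h * Z) {{ℕ.>-nonZero 1≤hZ}})
                                            (ℕ.m≤n*m (h * Z) B {{ℕ.>-nonZero 1≤B}}) ⟩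
  B * (h * Z) + B * (h * Z)   ≡⟨ rearrange B h Z ⟩
  B * (Z * X)                 ≡⟨ cong (λ t → B * (Z * t)) (ℕ.^-identityʳ X) ⟨
  B * (Z * X ^ 1)             ≡⟨ cong (B *_) (ℕ.^-distribˡ-+-* X (suc d * eNum d) 1) ⟨
  B * X ^ eNum (suc d)        ∎
  where
  open ℕ.≤-Reasoning
  X = 2 * h
  Z = X ^ (suc d * eNum d)
  Y^[1+d]≤Z : Y ^ suc d ≤ Z
  Y^[1+d]≤Z = begin
    Y ^ suc d                 ≤⟨ ℕ.^-monoˡ-≤ (suc d) Y≤X^E ⟩
    (X ^ eNum d) ^ suc d      ≡⟨ ℕ.^-*-assoc X (eNum d) (suc d) ⟩
    X ^ (eNum d * suc d)      ≡⟨ cong (X ^_) (ℕ.*-comm (eNum d) (suc d)) ⟩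
    Z                         ∎
  1≤hZ : 1 ≤ h * Z
  1≤hZ = ℕ.*-mono-≤ 1≤h (ℕ.m^n>0 X {{ℕ.>-nonZero (1≤2* 1≤h)}} (suc d * eNum d))
  rearrange : ∀ b h z → b * (h * z) + b * (h * z) ≡ b * (z * (2 * h))
  rearrange = ℕ-solve-∀

RepresentsWithin : ℕ → (Subset n → ℤ) → ℤ → ℕ → Set
RepresentsWithin {n} d f b B = Σ (Fin n → ℤ) λ a → evalForm d f a ≡ b × vecNorm a ≤ B

eNumBound : ℕ → (Subset n → ℤ) → ℤ → ℕ
eNumBound d f b = ∣ b ∣ * (2 * formHeight d f) ^ eNum d

representsWithin-mono : {f : Subset n → ℤ} {b : ℤ} {B B′ : ℕ} → B ≤ B′ →
  RepresentsWithin d f b B → RepresentsWithin d f b B′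
representsWithin-mono B≤B′ (a , Fa≡b , a≤B) = a , Fa≡b , ℕ.≤-trans a≤B B≤B′

represents-via-zeroAt : (i : Fin (suc n)) (f : Subset (suc n) → ℤ) {b : ℤ} {B : ℕ} →
  RepresentsWithin (suc d) (zeroAt i f) b B → RepresentsWithin (suc d) f b B
represents-via-zeroAt i f (a , Ha≡b , a≤B) =
  Vector.insertAt a i 0ℤ ,
  trans (evalForm-insertAt f i a 0ℤ) (trans (ℤ.+-identityˡ _) Ha≡b) ,
  vecNorm-insertAt a i 0ℤ z≤n a≤B

evalForm-at-unit-solution : (i : Fin (suc n)) (f : Subset (suc n) → ℤ) (a : Fin n → ℤ) →
  ∣ evalForm d (∂ i f) a ∣ ≡ 1 → (b : ℤ) →
  let ε = evalForm d (∂ i f) a ; H = evalForm (suc d) (zeroAt i f) a in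
  evalForm (suc d) f (Vector.insertAt a i (ε ℤ.* (b ℤ.- H))) ≡ b
evalForm-at-unit-solution {d = d} i f a ∣ε∣≡1 b = begin
  evalForm (suc d) f (Vector.insertAt a i (ε ℤ.* (b ℤ.- H)))
    ≡⟨ evalForm-insertAt f i a _ ⟩
  ε ℤ.* (b ℤ.- H) ℤ.* ε ℤ.+ H
    ≡⟨ rearrange ε b H ⟩
  (ε ℤ.* ε) ℤ.* (b ℤ.- H) ℤ.+ H
    ≡⟨ cong (λ x → x ℤ.* (b ℤ.- H) ℤ.+ H) (∣i∣≡1⇒i*i≡1 ε ∣ε∣≡1) ⟩
  1ℤ ℤ.* (b ℤ.- H) ℤ.+ H
    ≡⟨ cancel b H ⟩
  b ∎
  where
  open ≡-Reasoning
  ε = evalForm d (∂ i f) a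
  H = evalForm (suc d) (zeroAt i f) a
  rearrange : ∀ e b h → e ℤ.* (b ℤ.- h) ℤ.* e ℤ.+ h ≡ (e ℤ.* e) ℤ.* (b ℤ.- h) ℤ.+ h
  rearrange = solve-∀
  cancel : ∀ b h → 1ℤ ℤ.* (b ℤ.- h) ℤ.+ h ≡ b
  cancel = solve-∀

represents-via-unit : (i : Fin (suc n)) (f : Subset (suc n) → ℤ) (a : Fin n → ℤ) →
  ∣ evalForm d (∂ i f) a ∣ ≡ 1 → vecNorm a ≤ (2 * formHeight (suc d) f) ^ eNum d →
  AtMostOneNonzero (suc d) (zeroAt i f) → 1 ≤ formHeight (suc d) f →
  {b : ℤ} → b ≢ 0ℤ → RepresentsWithin (suc d) f b (eNumBound (suc d) f b)
represents-via-unit {d = d} i f a ∣ε∣≡1 a≤X^E atMostOne 1≤h {b} b≢0 =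
  Vector.insertAt a i x , evalForm-at-unit-solution i f a ∣ε∣≡1 b , vecNorm-insertAt a i x x≤bound a≤bound
  where
  open ℕ.≤-Reasoning
  ε = evalForm d (∂ i f) a
  H = evalForm (suc d) (zeroAt i f) a
  x = ε ℤ.* (b ℤ.- H)
  h = formHeight (suc d) f
  ∣H∣≤ : ∣ H ∣ ≤ h * vecNorm a ^ suc d
  ∣H∣≤ = ℕ.≤-trans (∣evalForm∣≤ (zeroAt i f) a atMostOne) (ℕ.*-monoˡ-≤ _ (formHeight-zeroAt f i))
  x≤bound : ∣ x ∣ ≤ eNumBound (suc d) f b
  x≤bound = begin
    ∣ ε ℤ.* (b ℤ.- H) ∣            ≡⟨ ℤ.abs-* ε (b ℤ.- H) ⟩
    ∣ ε ∣ * ∣ b ℤ.- H ∣            ≡⟨ cong (_* ∣ b ℤ.- H ∣) ∣ε∣≡1 ⟩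
    1 * ∣ b ℤ.- H ∣                ≡⟨ ℕ.*-identityˡ _ ⟩
    ∣ b ℤ.- H ∣                    ≤⟨ ℤ.∣i-j∣≤∣i∣+∣j∣ b H ⟩
    ∣ b ∣ + ∣ H ∣                  ≤⟨ ℕ.+-monoʳ-≤ ∣ b ∣ ∣H∣≤ ⟩
    ∣ b ∣ + h * vecNorm a ^ suc d  ≤⟨ eNum-step {d} (1≤∣i∣ b≢0) 1≤h a≤X^E ⟩
    eNumBound (suc d) f b          ∎
  a≤bound : vecNorm a ≤ eNumBound (suc d) f b
  a≤bound = begin
    vecNorm a                ≤⟨ a≤X^E ⟩
    (2 * h) ^ eNum d         ≤⟨ ^-eNum-mono (1≤2* 1≤h) d ⟩
    (2 * h) ^ eNum (suc d)   ≤⟨ ℕ.m≤n*m _ ∣ b ∣ {{ℕ.>-nonZero (1≤∣i∣ b≢0)}} ⟩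
    eNumBound (suc d) f b    ∎

-- As k ∈ K ∖ L, only the monomial x_K involves x_k; so at the point with xᵢ = u, x_k = v and
-- all other coordinates 1, F takes the value G_L·u + H_K·v.
represents-via-bézout : (i : Fin (suc n)) (f : Subset (suc n) → ℤ) {K L : Subset n} →
  card K ≡ suc d → IsMonomialAt (suc d) (zeroAt i f) K →
  card L ≡ d → IsMonomialAt d (∂ i f) L →
  Coprime ∣ ∂ i f L ∣ ∣ zeroAt i f K ∣ → ∂ i f L ≢ 0ℤ → {b : ℤ} → b ≢ 0ℤ →
  RepresentsWithin (suc d) f b (∣ b ∣ * (∣ ∂ i f L ∣ + ∣ zeroAt i f K ∣))
represents-via-bézout {n = zero} _ _ {[]} ()
represents-via-bézout {n = suc m} {d} i f {K} {L} ∣K∣≡1+d only-K ∣L∣≡d only-L coprime GL≢0 {b} b≢0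
  with k , k∈K , k∉L ← ∣q∣<∣p∣⇒∃[p∖q] K L (subst₂ _<_ (sym ∣L∣≡d) (sym ∣K∣≡1+d) ℕ.≤-refl)
  with u , v , GLu+HKv≡b , u≤B , v≤B ← bézout-scaled (∂ i f L) (zeroAt i f K) coprime b =
  Vector.insertAt e i u , Fa≡b ,
  vecNorm-insertAt e i u u≤B (vecNorm-insertAt (λ _ → 1ℤ) k v v≤B (vecNorm-lub {m} (λ _ → 1ℤ) λ _ → 1≤B))
  where
  open ≡-Reasoning
  G = ∂ i f
  H = zeroAt i f
  e = Vector.insertAt (λ _ → 1ℤ) k v
  1≤B : 1 ≤ ∣ b ∣ * (∣ G L ∣ + ∣ H K ∣)
  1≤B = ℕ.*-mono-≤ (1≤∣i∣ b≢0) (ℕ.≤-trans (1≤∣i∣ GL≢0) (ℕ.m≤m+n _ _))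
  Ge≡GL : evalForm d G e ≡ G L
  Ge≡GL = begin
    evalForm d G e                         ≡⟨ evalForm-monomial G e ∣L∣≡d only-L ⟩
    G L ℤ.* monomial L e                   ≡⟨ cong (G L ℤ.*_) (monomial-insertAt-1s L k v) ⟩
    G L ℤ.* (if lookup L k then v else 1ℤ) ≡⟨ cong (λ c → G L ℤ.* (if c then v else 1ℤ)) k∉L ⟩
    G L ℤ.* 1ℤ                             ≡⟨ ℤ.*-identityʳ (G L) ⟩
    G L                                    ∎
  He≡HKv : evalForm (suc d) H e ≡ H K ℤ.* v
  He≡HKv = begin
    evalForm (suc d) H e                   ≡⟨ evalForm-monomial H e ∣K∣≡1+d only-K ⟩
    H K ℤ.* monomial K e                   ≡⟨ cong (H K ℤ.*_) (monomial-insertAt-1s K k v) ⟩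
    H K ℤ.* (if lookup K k then v else 1ℤ) ≡⟨ cong (λ c → H K ℤ.* (if c then v else 1ℤ)) k∈K ⟩
    H K ℤ.* v                              ∎
  Fa≡b : evalForm (suc d) f (Vector.insertAt e i u) ≡ b
  Fa≡b = begin
    evalForm (suc d) f (Vector.insertAt e i u)      ≡⟨ evalForm-insertAt f i e u ⟩
    u ℤ.* evalForm d G e ℤ.+ evalForm (suc d) H e   ≡⟨ cong₂ (λ g h → u ℤ.* g ℤ.+ h) Ge≡GL He≡HKv ⟩
    u ℤ.* G L ℤ.+ H K ℤ.* v                         ≡⟨ cong (ℤ._+ H K ℤ.* v) (ℤ.*-comm u (G L)) ⟩
    G L ℤ.* u ℤ.+ H K ℤ.* v                         ≡⟨ GLu+HKv≡b ⟩
    b                                               ∎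

-- By pairwise coprimality a non-coprime restriction has at most one nonzero coefficient,
-- and since F is coprime neither restriction vanishes.
represents-when-restrictions-not-coprime : (i : Fin (suc n)) (f : Subset (suc n) → ℤ) →
  IsCoprimeForm (suc d) f → PairwiseCoprimeCoeffs (suc d) f →
  ¬ IsCoprimeForm (suc d) (zeroAt i f) → ¬ IsCoprimeForm d (∂ i f) →
  {b : ℤ} → b ≢ 0ℤ → RepresentsWithin (suc d) f b (eNumBound (suc d) f b)
represents-when-restrictions-not-coprime {d = d} i f coprime pairwise ¬coprime-H ¬coprime-G {b} b≢0
  with nonzeroCoeff-or-vanishes (suc d) (zeroAt i f) | nonzeroCoeff-or-vanishes d (∂ i f)
... | inj₂ H≡0 | _        = contradiction (coprime-∂-of-zeroAt-vanishing i f coprime H≡0) ¬coprime-G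
... | _        | inj₂ G≡0 = contradiction (coprime-zeroAt-of-∂-vanishing i f coprime G≡0) ¬coprime-H
... | inj₁ (K , ∣K∣≡1+d , HK≢0) | inj₁ (L , ∣L∣≡d , GL≢0) =
  representsWithin-mono {f = f} B≤eNumBound
    (represents-via-bézout i f ∣K∣≡1+d (atMostOneNonzero⇒monomialAt H-atMostOne ∣K∣≡1+d HK≢0)
                               ∣L∣≡d   (atMostOneNonzero⇒monomialAt G-atMostOne ∣L∣≡d GL≢0)
                               coprime-GL-HK GL≢0 b≢0)
  where
  open ℕ.≤-Reasoning
  h = formHeight (suc d) f
  H-atMostOne = ¬coprime⇒atMostOneNonzero (pairwiseCoprime-zeroAt i pairwise) ¬coprime-H
  G-atMostOne = ¬coprime⇒atMostOneNonzero (pairwiseCoprime-∂ i pairwise) ¬coprime-G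
  coprime-GL-HK : Coprime ∣ ∂ i f L ∣ ∣ zeroAt i f K ∣
  coprime-GL-HK =
    pairwise _ _ (trans (∣insertAt-inside∣ L i) (cong suc ∣L∣≡d)) (trans (∣insertAt-outside∣ K i) ∣K∣≡1+d)
             (insertAt-inside≢insertAt-outside i L K) GL≢0 HK≢0
  GL≤h : ∣ ∂ i f L ∣ ≤ h
  GL≤h = ℕ.≤-trans (≤-formHeight (∂ i f) ∣L∣≡d) (formHeight-∂ f i)
  HK≤h : ∣ zeroAt i f K ∣ ≤ h
  HK≤h = ℕ.≤-trans (≤-formHeight (zeroAt i f) ∣K∣≡1+d) (formHeight-zeroAt f i)
  1≤h : 1 ≤ h
  1≤h = ℕ.≤-trans (1≤∣i∣ HK≢0) HK≤h
  B≤eNumBound : ∣ b ∣ * (∣ ∂ i f L ∣ + ∣ zeroAt i f K ∣) ≤ eNumBound (suc d) f b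
  B≤eNumBound = ℕ.*-monoʳ-≤ ∣ b ∣ (begin
    ∣ ∂ i f L ∣ + ∣ zeroAt i f K ∣  ≤⟨ ℕ.+-mono-≤ GL≤h HK≤h ⟩
    h + h                           ≡⟨ cong (_+_ h) (ℕ.+-identityʳ h) ⟨
    2 * h                           ≡⟨ ℕ.^-identityʳ (2 * h) ⟨
    (2 * h) ^ 1                     ≤⟨ ℕ.^-monoʳ-≤ (2 * h) {{ℕ.>-nonZero (1≤2* 1≤h)}} (1≤eNum (suc d)) ⟩
    (2 * h) ^ eNum (suc d)          ∎)

represents-unit-pairwise : (f : Subset n → ℤ) → IsCoprimeForm d f → PairwiseCoprimeCoeffs d f →
  ∃[ a ] ∣ evalForm d f a ∣ ≡ 1 × vecNorm a ≤ (2 * formHeight d f) ^ eNum d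
represents-pairwise : (f : Subset n → ℤ) → IsCoprimeForm (suc d) f → PairwiseCoprimeCoeffs (suc d) f →
  {b : ℤ} → b ≢ 0ℤ → RepresentsWithin (suc d) f b (eNumBound (suc d) f b)

represents-unit-pairwise {n} {zero} f coprime _ =
  (λ _ → 0ℤ) ,
  trans (cong ∣_∣ (evalForm-degree-0 f _)) (coprimeForm-degree-0 f coprime) ,
  vecNorm-lub {n} _ (λ _ → z≤n)
represents-unit-pairwise {d = suc d} f coprime pairwise
  with a , Fa≡1 , a≤bound ← represents-pairwise f coprime pairwise {1ℤ} (λ ()) =
  a , cong ∣_∣ Fa≡1 , ℕ.≤-trans a≤bound (ℕ.≤-reflexive (ℕ.*-identityˡ _))

represents-pairwise {zero} f coprime _ _ with coprimeForm⇒nonzeroCoeff f coprime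
... | [] , () , _
represents-pairwise {suc n} {d} f coprime pairwise {b} b≢0
  with isCoprimeForm? (suc d) (zeroAt fzero f) | isCoprimeForm? d (∂ fzero f)
... | yes coprime-H | _ =
  representsWithin-mono {f = f} (ℕ.*-monoʳ-≤ ∣ b ∣ (^-mono-formHeight (eNum (suc d)) (formHeight-zeroAt f fzero)))
    (represents-via-zeroAt fzero f
      (represents-pairwise (zeroAt fzero f) coprime-H (pairwiseCoprime-zeroAt fzero pairwise) b≢0))
... | no ¬coprime-H | yes coprime-G
  with a , ∣Ga∣≡1 , a≤bound
         ← represents-unit-pairwise (∂ fzero f) coprime-G (pairwiseCoprime-∂ fzero pairwise) =
  represents-via-unit fzero f a ∣Ga∣≡1
    (ℕ.≤-trans a≤bound (^-mono-formHeight (eNum d) (formHeight-∂ f fzero)))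
    (¬coprime⇒atMostOneNonzero (pairwiseCoprime-zeroAt fzero pairwise) ¬coprime-H)
    (coprimeForm⇒1≤formHeight f coprime) b≢0
... | no ¬coprime-H | no ¬coprime-G =
  represents-when-restrictions-not-coprime fzero f coprime pairwise ¬coprime-H ¬coprime-G b≢0

represents-coprime-pair : (f : Subset (suc (suc d)) → ℤ) {p q : Subset (suc (suc d))} →
  card p ≡ suc d → card q ≡ suc d → p ≢ q → Coprime ∣ f p ∣ ∣ f q ∣ →
  {b : ℤ} → b ≢ 0ℤ → RepresentsWithin (suc d) f b (eNumBound (suc d) f b)
represents-coprime-pair {zero} f ∣p∣≡1 ∣q∣≡1 p≢q coprime =
  represents-pairwise f (coprimePair⇒coprimeForm f ∣p∣≡1 ∣q∣≡1 coprime)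
                        (pairwiseCoprime-binary-linear f ∣p∣≡1 ∣q∣≡1 p≢q coprime)
represents-coprime-pair {suc d} f {p} {q} ∣p∣≡2+d ∣q∣≡2+d p≢q coprime {b} b≢0
  with i , i∈p , i∈q
         ← n<∣p∣+∣q∣⇒∃[p∩q] p q (subst₂ (λ x y → 3 + d < x + y) (sym ∣p∣≡2+d) (sym ∣q∣≡2+d)
                                       (s≤s (s≤s (ℕ.m≤n+m (suc (suc d)) d))))
  with _ , _ , ∣p′∣≡1+d , ∣q′∣≡1+d , p′≢q′ , coprime′
         ← coprimePair-∂ f i i∈p i∈q ∣p∣≡2+d ∣q∣≡2+d p≢q coprime
  with a , ∂a≡1 , a≤bound
         ← represents-coprime-pair (∂ i f) ∣p′∣≡1+d ∣q′∣≡1+d p′≢q′ coprime′ {1ℤ} (λ ()) =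
  represents-via-unit i f a (cong ∣_∣ ∂a≡1)
    (ℕ.≤-trans a≤bound (ℕ.≤-trans (ℕ.≤-reflexive (ℕ.*-identityˡ _))
                                  (^-mono-formHeight (eNum (suc d)) (formHeight-∂ f i))))
    (atMostOneNonzero-full (zeroAt i f))
    (coprimeForm⇒1≤formHeight f (coprimePair⇒coprimeForm f ∣p∣≡2+d ∣q∣≡2+d coprime)) b≢0

represents : (f : Subset n → ℤ) → IsCoprimeForm (suc d) f →
  PairwiseCoprimeCoeffs (suc d) f ⊎
    (n ≡ suc d + 1 × ∃[ p ] ∃[ q ] card p ≡ suc d × card q ≡ suc d × p ≢ q × Coprime ∣ f p ∣ ∣ f q ∣) →
  (b : ℤ) → RepresentsWithin (suc d) f b (eNumBound (suc d) f b)
represents {n} {d} f coprime hypothesis b with b ℤ.≟ 0ℤ | hypothesis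
... | yes refl | _             = (λ _ → 0ℤ) , evalForm-0s f , vecNorm-lub {n} _ (λ _ → z≤n)
... | no b≢0   | inj₁ pairwise = represents-pairwise f coprime pairwise b≢0
... | no b≢0   | inj₂ (n≡1+d+1 , p , q , ∣p∣≡1+d , ∣q∣≡1+d , p≢q , coprime-pq)
  with refl ← trans n≡1+d+1 (ℕ.+-comm (suc d) 1) =
  represents-coprime-pair f ∣p∣≡1+d ∣q∣≡1+d p≢q coprime-pq b≢0

-- The exponent d!·e

*-^-distrib : (m n q : ℕ) → (m * n) ^ q ≡ m ^ q * n ^ q
*-^-distrib m n zero    = refl
*-^-distrib m n (suc q) = trans (cong (m * n *_) (*-^-distrib m n q)) (interchange m n (m ^ q) (n ^ q))
  where
  interchange : ∀ m n x y → m * n * (x * y) ≡ m * x * (n * y)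
  interchange = ℕ-solve-∀

≤-eNum⇒LeEulerBound : {A B X : ℕ} (d : ℕ) → 1 ≤ X → A ≤ B * X ^ eNum d → LeEulerBound A B X d
≤-eNum⇒LeEulerBound {A} {B} {X} d 1≤X A≤BX^E p q _ above = begin
  A ^ q                  ≤⟨ ℕ.^-monoˡ-≤ q A≤BX^E ⟩
  (B * X ^ E) ^ q        ≡⟨ *-^-distrib B (X ^ E) q ⟩
  B ^ q * (X ^ E) ^ q    ≡⟨ cong (B ^ q *_) (ℕ.^-*-assoc X E q) ⟩
  B ^ q * X ^ (E * q)    ≤⟨ ℕ.*-monoʳ-≤ (B ^ q) (ℕ.^-monoʳ-≤ X {{ℕ.>-nonZero 1≤X}} Eq≤p) ⟩
  B ^ q * X ^ p          ∎
  where
  open ℕ.≤-Reasoning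
  E = eNum d
  Eq≤p : E * q ≤ p
  Eq≤p = ℕ.*-cancelˡ-≤ (d !) {{d ℕ.!≢0}} (begin
    d ! * (E * q)  ≡⟨ cong (d ! *_) (ℕ.*-comm E q) ⟩
    d ! * (q * E)  ≡⟨ ℕ.*-assoc (d !) q E ⟨
    d ! * q * E    ≤⟨ above d ⟩
    p * d !        ≡⟨ ℕ.*-comm p (d !) ⟩
    d ! * p        ∎)

theorem1 : (n d : ℕ) → 1 ≤ n → 1 ≤ d → d ≤ n → (f : Subset n → ℤ) →
  (∀ (k : ℕ) → (∀ (I : Subset n) → card I ≡ d → k ∣ ∣ f I ∣) → k ≡ 1) →
  ((∀ (I J : Subset n) → card I ≡ d → card J ≡ d → I ≢ J →
      f I ≢ 0ℤ → f J ≢ 0ℤ → Coprime ∣ f I ∣ ∣ f J ∣)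
   ⊎ (n ≡ d + 1 × Σ (Subset n) (λ I → Σ (Subset n) (λ J →
        card I ≡ d × card J ≡ d × I ≢ J × Coprime ∣ f I ∣ ∣ f J ∣)))) →
  (b : ℤ) → Σ (Fin n → ℤ) (λ a →
    evalForm d f a ≡ b × LeEulerBound (vecNorm a) ∣ b ∣ (2 * formHeight d f) d)
theorem1 n zero    _ () _ f coprime hypothesis b
theorem1 n (suc d) _ _  _ f coprime hypothesis b
  with a , Fa≡b , a≤bound ← represents f coprime hypothesis b =
  a , Fa≡b , ≤-eNum⇒LeEulerBound (suc d) (1≤2* (coprimeForm⇒1≤formHeight f coprime)) a≤bound
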